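{- Let $G$ be a cactus graph on $n\geq 4$ vertices containing at least two cycles. Then $\operatorname{Z}(\overline{G})\geq n-4$. Furthermore, if $G$ does not contain a $4$-cycle $C_4$, then $\operatorname{Z}(\overline{G})\geq n-3$.
   Context: All graphs are finite, simple and undirected. A cactus graph is a connected graph in which any two simple cycles have at most one vertex in common. $\overline{G}$ denotes the complement of $G$ (same vertex set; distinct vertices adjacent iff not adjacent in $G$). Zero forcing: given an initial set $B\subseteq V(G)$ of blue vertices (all others white), a blue vertex with exactly one white neighbor may turn that neighbor blue; $B$ is a zero forcing set if repeated application makes all vertices blue. $\operatorname{Z}(G)$ is the minimum size of a zero forcing set of $G$. -}

module Defs where

open import Data.Bool using (Bool; true; false; not; _∧_; T)
open import Data.Nat using (ℕ; _≤_)
open import Data.Fin using (Fin; _≟_)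
open import Data.Fin.Subset using (Subset; _∈_; _∉_; ⁅_⁆; _∪_; ∣_∣)
open import Data.List using (List; []; _∷_; _++_; [_]; length)
open import Data.List.Relation.Unary.Linked using (Linked)
open import Data.List.Relation.Unary.Unique.Propositional using (Unique)
open import Data.Product using (Σ; ∃; ∃-syntax; _×_; _,_)
open import Data.Sum using (_⊎_)
open import Relation.Nullary using (¬_; does)
open import Relation.Binary.PropositionalEquality using (_≡_; _≢_; refl; sym; cong)
open import Relation.Binary.Construct.Closure.ReflexiveTransitive using (Star)
open import Function.Bundles using (_⇔_)

record Graph (n : ℕ) : Set where
  field
    adj   : Fin n → Fin n → Bool
    adj-sym : ∀ u v → adj u v ≡ adj v u
    adj-irr : ∀ u → adj u u ≡ false

open Graph public using (adj)

E : ∀ {n} → Graph n → Fin n → Fin n → Set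
E G u v = adj G u v ≡ true

private
  ≟-sym : ∀ {n} (u v : Fin n) → does (u ≟ v) ≡ does (v ≟ u)
  ≟-sym u v with u ≟ v | v ≟ u
  ... | Relation.Nullary.yes _ | Relation.Nullary.yes _ = refl
  ... | Relation.Nullary.no _  | Relation.Nullary.no _  = refl
  ... | Relation.Nullary.yes p | Relation.Nullary.no q  = Data.Empty.⊥-elim (q (sym p))
    where import Data.Empty
  ... | Relation.Nullary.no p  | Relation.Nullary.yes q = Data.Empty.⊥-elim (p (sym q))
    where import Data.Empty

  ≟-refl : ∀ {n} (u : Fin n) → does (u ≟ u) ≡ true
  ≟-refl u with u ≟ u
  ... | Relation.Nullary.yes _ = refl
  ... | Relation.Nullary.no p  = Data.Empty.⊥-elim (p refl)
    where import Data.Empty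

  ∧-false : ∀ b → b ∧ false ≡ false
  ∧-false true  = refl
  ∧-false false = refl

complement : ∀ {n} → Graph n → Graph n
complement G = record
  { adj   = λ u v → not (adj G u v) ∧ not (does (u ≟ v))
  ; adj-sym = λ u v → Relation.Binary.PropositionalEquality.cong₂ (λ a b → not a ∧ not b) (Graph.adj-sym G u v) (≟-sym u v)
  ; adj-irr = λ u → Relation.Binary.PropositionalEquality.trans
              (cong (λ b → not (adj G u u) ∧ not b) (≟-refl u)) (∧-false _)
  }

Walk : ∀ {n} → Graph n → Fin n → Fin n → Set
Walk G u v = u ≡ v ⊎ ∃[ ws ] Linked (E G) (u ∷ ws ++ [ v ])

Connected : ∀ {n} → Graph n → Set
Connected G = ∀ u v → Walk G u v

CycleSeq : ℕ → Set
CycleSeq n = Fin n × List (Fin n)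

closedWalk : ∀ {n} → CycleSeq n → List (Fin n)
closedWalk (x , xs) = x ∷ xs ++ [ x ]

verts : ∀ {n} → CycleSeq n → List (Fin n)
verts (x , xs) = x ∷ xs

cycLength : ∀ {n} → CycleSeq n → ℕ
cycLength c = length (verts c)

IsCycle : ∀ {n} → Graph n → CycleSeq n → Set
IsCycle G c = Unique (verts c) × 3 ≤ cycLength c × Linked (E G) (closedWalk c)

CycEdge : ∀ {n} → CycleSeq n → Fin n → Fin n → Set
CycEdge c u v = ∃[ ys ] ∃[ zs ] (closedWalk c ≡ ys ++ u ∷ v ∷ zs ⊎ closedWalk c ≡ ys ++ v ∷ u ∷ zs)

-- two cycle sequences describe the same cycle (subgraph) iff they have the same edges
SameCycle : ∀ {n} → CycleSeq n → CycleSeq n → Set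
SameCycle c d = ∀ u v → CycEdge c u v ⇔ CycEdge d u v

OnCycle : ∀ {n} → Fin n → CycleSeq n → Set
OnCycle v c = Data.List.Membership.Propositional._∈_ v (verts c)
  where import Data.List.Membership.Propositional

ShareTwo : ∀ {n} → CycleSeq n → CycleSeq n → Set
ShareTwo c d = ∃[ u ] ∃[ v ] (u ≢ v × OnCycle u c × OnCycle u d × OnCycle v c × OnCycle v d)

Cactus : ∀ {n} → Graph n → Set
Cactus G = Connected G ×
  (∀ c d → IsCycle G c → IsCycle G d → ShareTwo c d → SameCycle c d)

AtLeastTwoCycles : ∀ {n} → Graph n → Set
AtLeastTwoCycles G = ∃[ c ] ∃[ d ] (IsCycle G c × IsCycle G d × ¬ SameCycle c d)

HasC4 : ∀ {n} → Graph n → Set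
HasC4 G = ∃[ c ] (IsCycle G c × cycLength c ≡ 4)

ForceStep : ∀ {n} → Graph n → Subset n → Subset n → Set
ForceStep G S S' = ∃[ u ] ∃[ v ]
  (u ∈ S × v ∉ S × E G u v × (∀ w → E G u w → w ≢ v → w ∈ S) × S' ≡ ⁅ v ⁆ ∪ S)

IsZeroForcingSet : ∀ {n} → Graph n → Subset n → Set
IsZeroForcingSet G B = ∃[ S ] (Star (ForceStep G) B S × (∀ v → v ∈ S))

ZLowerBound : ∀ {n} → Graph n → ℕ → Set
ZLowerBound G k = ∀ B → IsZeroForcingSet G B → k ≤ ∣ B ∣

-- Let B be a zero forcing set of the complement of G that leaves at least k + 2
-- vertices white.  A vertex u forcing v in the complement is, in G, adjacent to
-- every white vertex other than v.  Hence the forcing vertices u ≠ u' of the first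
-- two forces have at least k common G-neighbours.  Two common neighbours of
-- distinct vertices span a 4-cycle, and three span two 4-cycles meeting in two
-- vertices, which a cactus forbids.  So at most 4 vertices (at most 3 if G has
-- no C₄) are white, i.e. |B| ≥ n − 4 (resp. n − 3).
module Submission where

open import Defs
open import Data.Nat using (ℕ; suc; _+_; _≤_; _∸_; s≤s; z≤n)
open import Data.Nat.Properties
  using (≤-trans; ≤-refl; n≤1+n; ≮⇒≥; <⇒≱; m≤m+n; +-cancelˡ-≤; +-monoʳ-≤;
         +-comm; m≤n+m∸n; m≤n+o⇒m∸n≤o)
open import Data.Bool using (true; false)
open import Data.Fin using (Fin; _≟_)
open import Data.Fin.Subset using (Subset; _∈_; _∉_; ⁅_⁆; _∪_; _─_; _-_; ∁; ∣_∣; inside; outside)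
  renaming (⊥ to ∅)
open import Data.Fin.Subset.Properties
  using (p─⊥≡p; p─q⊆p; x∈⁅x⁆; x∈⁅y⁆⇒x≡y; x∈p∪q⁻; x∈p∪q⁺; x∈∁p⇒x∉p;
         p⊆q⇒∣p∣≤∣q∣; ∣⊥∣≡0; ∣⁅x⁆∣≡1; ∣∁p∣≡n∸∣p∣)
open import Data.Vec using (_∷_; here; there)
open import Data.List using ([]; _∷_)
open import Data.List.Relation.Unary.Linked using ([-]; _∷_)
open import Data.List.Relation.Unary.AllPairs using ([]; _∷_)
open import Data.List.Relation.Unary.All using ([]; _∷_)
open import Data.List.Relation.Unary.Any using (here; there)
open import Data.Product using (_×_; _,_; ∃-syntax)
open import Data.Sum using (_⊎_; inj₁; inj₂; [_,_])
open import Data.Empty using (⊥; ⊥-elim)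
open import Function using (_∘_; id)
open import Function.Bundles using (Equivalence)
open import Relation.Nullary using (¬_; yes; no)
open import Relation.Binary.PropositionalEquality using (_≡_; _≢_; refl; sym; trans; subst)
open import Relation.Binary.Construct.Closure.ReflexiveTransitive using (ε; _◅_)

private
  variable
    m : ℕ

m∸n≤o⇒m∸o≤n : ∀ m n o → m ∸ n ≤ o → m ∸ o ≤ n
m∸n≤o⇒m∸o≤n m n o m∸n≤o = m≤n+o⇒m∸n≤o m o
  (subst (m ≤_) (+-comm n o) (≤-trans (m≤n+m∸n m n) (+-monoʳ-≤ n m∸n≤o)))

∣p∣≤1+∣p-x∣ : (p : Subset m) (x : Fin m) → ∣ p ∣ ≤ suc ∣ p - x ∣
∣p∣≤1+∣p-x∣ (inside  ∷ p) Fin.zero    = subst (λ q → suc ∣ p ∣ ≤ suc ∣ q ∣) (sym (p─⊥≡p p)) ≤-refl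
∣p∣≤1+∣p-x∣ (outside ∷ p) Fin.zero    = subst (λ q → ∣ p ∣ ≤ suc ∣ q ∣) (sym (p─⊥≡p p)) (n≤1+n _)
∣p∣≤1+∣p-x∣ (inside  ∷ p) (Fin.suc x) = s≤s (∣p∣≤1+∣p-x∣ p x)
∣p∣≤1+∣p-x∣ (outside ∷ p) (Fin.suc x) = ∣p∣≤1+∣p-x∣ p x

¬2+k≤∣∁p∣ : ∀ {k} {p : Subset m} (q : Subset m) → ∣ q ∣ ≤ 1 → (∀ x → x ∈ q ∪ p) → ¬ (2 + k ≤ ∣ ∁ p ∣)
¬2+k≤∣∁p∣ {k = k} {p} q ∣q∣≤1 cover 2+k≤∣∁p∣ =
  <⇒≱ (≤-trans (m≤m+n 2 k) 2+k≤∣∁p∣) (≤-trans (p⊆q⇒∣p∣≤∣q∣ {q = q} ∁p⊆q) ∣q∣≤1)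
  where
  ∁p⊆q : ∀ {x} → x ∈ ∁ p → x ∈ q
  ∁p⊆q {x} x∈∁p = [ id , ⊥-elim ∘ x∈∁p⇒x∉p x∈∁p ] (x∈p∪q⁻ q p (cover x))

x∈p─q⇒x∉q : {x : Fin m} (p q : Subset m) → x ∈ p ─ q → x ∉ q
x∈p─q⇒x∉q (_ ∷ p) (outside ∷ q) here      ()
x∈p─q⇒x∉q (_ ∷ p) (inside  ∷ q) ()        here
x∈p─q⇒x∉q (_ ∷ p) (_       ∷ q) (there i) (there j) = x∈p─q⇒x∉q p q i j

x∈p-y⁻ : {x y : Fin m} (p : Subset m) → x ∈ p - y → x ∈ p × x ≢ y
x∈p-y⁻ {y = y} p x∈p-y = p─q⊆p p ⁅ y ⁆ x∈p-y ,
  λ { refl → x∈p─q⇒x∉q p ⁅ y ⁆ x∈p-y (x∈⁅x⁆ y) }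

choose : ∀ {k} (p : Subset m) → suc k ≤ ∣ p ∣ → ∃[ x ] (x ∈ p × k ≤ ∣ p - x ∣)
choose {k = k} (inside ∷ p) (s≤s k≤∣p∣) = Fin.zero , here , subst (λ q → k ≤ ∣ q ∣) (sym (p─⊥≡p p)) k≤∣p∣
choose (outside ∷ p) k<∣p∣ with choose p k<∣p∣
... | x , x∈p , k≤∣p-x∣ = Fin.suc x , there x∈p , k≤∣p-x∣

choose₂ : (p : Subset m) → 2 ≤ ∣ p ∣ → ∃[ x ] ∃[ y ] (x ∈ p × y ∈ p × x ≢ y)
choose₂ p 2≤∣p∣ with choose p 2≤∣p∣
... | x , x∈p , 1≤∣p-x∣ with choose (p - x) 1≤∣p-x∣
... | y , y∈p-x , _ with x∈p-y⁻ p y∈p-x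
... | y∈p , y≢x = x , y , x∈p , y∈p , y≢x ∘ sym

choose₃ : (p : Subset m) → 3 ≤ ∣ p ∣ →
  ∃[ x ] ∃[ y ] ∃[ z ] (x ∈ p × y ∈ p × z ∈ p × x ≢ y × x ≢ z × y ≢ z)
choose₃ p 3≤∣p∣ with choose p 3≤∣p∣
... | x , x∈p , 2≤∣p-x∣ with choose₂ (p - x) 2≤∣p-x∣
... | y , z , y∈p-x , z∈p-x , y≢z with x∈p-y⁻ p y∈p-x | x∈p-y⁻ p z∈p-x
... | y∈p , y≢x | z∈p , z≢x = x , y , z , x∈p , y∈p , z∈p , y≢x ∘ sym , z≢x ∘ sym , y≢z

CycEdge-square : {a b c d z : Fin m} → a ≢ c → b ≢ c → c ≢ d →
  CycEdge (a , b ∷ c ∷ d ∷ []) c z → z ≡ b ⊎ z ≡ d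
CycEdge-square a≢c b≢c c≢d ([]                        , _ , inj₁ refl) = ⊥-elim (a≢c refl)
CycEdge-square a≢c b≢c c≢d (_ ∷ []                    , _ , inj₁ refl) = ⊥-elim (b≢c refl)
CycEdge-square a≢c b≢c c≢d (_ ∷ _ ∷ []                , _ , inj₁ refl) = inj₂ refl
CycEdge-square a≢c b≢c c≢d (_ ∷ _ ∷ _ ∷ []            , _ , inj₁ refl) = ⊥-elim (c≢d refl)
CycEdge-square a≢c b≢c c≢d (_ ∷ _ ∷ _ ∷ _ ∷ []        , _ , inj₁ ())
CycEdge-square a≢c b≢c c≢d (_ ∷ _ ∷ _ ∷ _ ∷ _ ∷ []    , _ , inj₁ ())
CycEdge-square a≢c b≢c c≢d (_ ∷ _ ∷ _ ∷ _ ∷ _ ∷ _ ∷ _ , _ , inj₁ ())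
CycEdge-square a≢c b≢c c≢d ([]                        , _ , inj₂ refl) = ⊥-elim (b≢c refl)
CycEdge-square a≢c b≢c c≢d (_ ∷ []                    , _ , inj₂ refl) = inj₁ refl
CycEdge-square a≢c b≢c c≢d (_ ∷ _ ∷ []                , _ , inj₂ refl) = ⊥-elim (c≢d refl)
CycEdge-square a≢c b≢c c≢d (_ ∷ _ ∷ _ ∷ []            , _ , inj₂ refl) = ⊥-elim (a≢c refl)
CycEdge-square a≢c b≢c c≢d (_ ∷ _ ∷ _ ∷ _ ∷ []        , _ , inj₂ ())
CycEdge-square a≢c b≢c c≢d (_ ∷ _ ∷ _ ∷ _ ∷ _ ∷ []    , _ , inj₂ ())
CycEdge-square a≢c b≢c c≢d (_ ∷ _ ∷ _ ∷ _ ∷ _ ∷ _ ∷ _ , _ , inj₂ ())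

module _ {n : ℕ} (G : Graph n) where

  E⇒≢ : ∀ {u v} → E G u v → u ≢ v
  E⇒≢ {u} uv refl with trans (sym uv) (Graph.adj-irr G u)
  ... | ()

  E-sym : ∀ {u v} → E G u v → E G v u
  E-sym {u} {v} uv = trans (Graph.adj-sym G v u) uv

  E⊎E-complement : ∀ {u v} → u ≢ v → E G u v ⊎ E (complement G) u v
  E⊎E-complement {u} {v} u≢v with adj G u v | u ≟ v
  ... | true  | _       = inj₁ refl
  ... | false | no _    = inj₂ refl
  ... | false | yes u≡v = ⊥-elim (u≢v u≡v)

  CommonNeighbour : Fin n → Fin n → Fin n → Set
  CommonNeighbour u u' x = E G u x × E G u' x

  square : ∀ {u u' x y} → u ≢ u' → x ≢ y → CommonNeighbour u u' x → CommonNeighbour u u' y →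
    IsCycle G (u , x ∷ u' ∷ y ∷ [])
  square u≢u' x≢y (ux , u'x) (uy , u'y) =
    ( (E⇒≢ ux ∷ u≢u' ∷ E⇒≢ uy ∷ []) ∷ (E⇒≢ u'x ∘ sym ∷ x≢y ∷ []) ∷ (E⇒≢ u'y ∷ []) ∷ [] ∷ [])
    , s≤s (s≤s (s≤s z≤n))
    , ux ∷ E-sym u'x ∷ u'y ∷ E-sym uy ∷ [-]

  CyclesMeetInAtMostOneVertex : Set
  CyclesMeetInAtMostOneVertex = ∀ c d → IsCycle G c → IsCycle G d → ShareTwo c d → SameCycle c d

  -- The squares u x u' y and u x u' z share u and x, but only the second uses the edge u'z.
  cactus⇒¬K₂₃ : CyclesMeetInAtMostOneVertex →
    ∀ {u u' x y z} → u ≢ u' → x ≢ y → x ≢ z → y ≢ z →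
    CommonNeighbour u u' x → CommonNeighbour u u' y → CommonNeighbour u u' z → ⊥
  cactus⇒¬K₂₃ cactus {u} {u'} {x} {y} {z} u≢u' x≢y x≢z y≢z ux@(u~x , u'~x) uy@(_ , u'~y) uz
    with CycEdge-square u≢u' (E⇒≢ u'~x ∘ sym) (E⇒≢ u'~y)
           (Equivalence.from (same u' z) ((u ∷ x ∷ []) , (u ∷ []) , inj₁ refl))
    where
    same : SameCycle (u , x ∷ u' ∷ y ∷ []) (u , x ∷ u' ∷ z ∷ [])
    same = cactus _ _ (square u≢u' x≢y ux uy) (square u≢u' x≢z ux uz)
      (u , x , E⇒≢ u~x , here refl , here refl , there (here refl) , there (here refl))
  ... | inj₁ z≡x = x≢z (sym z≡x)
  ... | inj₂ z≡y = y≢z (sym z≡y)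

  record CommonNeighbourhood (k : ℕ) : Set where
    field
      u u'   : Fin n
      u≢u'   : u ≢ u'
      D      : Subset n
      k≤∣D∣  : k ≤ ∣ D ∣
      common : ∀ {x} → x ∈ D → CommonNeighbour u u' x

  forcer-adjacent : ∀ {S u v x} → u ∈ S → (∀ w → E (complement G) u w → w ≢ v → w ∈ S) →
    x ∉ S → x ≢ v → E G u x
  forcer-adjacent u∈S forces x∉S x≢v with E⊎E-complement (λ { refl → x∉S u∈S })
  ... | inj₁ ux = ux
  ... | inj₂ ūx = ⊥-elim (x∉S (forces _ ūx x≢v))

  zeroForcing⇒commonNeighbourhood : ∀ {B k} → IsZeroForcingSet (complement G) B →
    2 + k ≤ ∣ ∁ B ∣ → CommonNeighbourhood k
  zeroForcing⇒commonNeighbourhood (_ , ε , all-blue) 2+k≤∣∁B∣ =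
    ⊥-elim (¬2+k≤∣∁p∣ ∅ (subst (_≤ 1) (sym (∣⊥∣≡0 n)) z≤n) (x∈p∪q⁺ ∘ inj₂ ∘ all-blue) 2+k≤∣∁B∣)
  zeroForcing⇒commonNeighbourhood (_ , (_ , v , _ , _ , _ , _ , refl) ◅ ε , all-blue) 2+k≤∣∁B∣ =
    ⊥-elim (¬2+k≤∣∁p∣ ⁅ v ⁆ (subst (_≤ 1) (sym (∣⁅x⁆∣≡1 v)) ≤-refl) all-blue 2+k≤∣∁B∣)
  zeroForcing⇒commonNeighbourhood {B} {k}
    (_ , (u , v , u∈B , v∉B , _ , u-forces , refl) ◅ (u' , v' , u'∈S₁ , v'∉S₁ , u'v' , u'-forces , refl) ◅ _ , _)
    2+k≤∣∁B∣ = record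
      { u = u ; u' = u' ; u≢u' = u≢u' ; D = ∁ B - v - v'
      ; k≤∣D∣ = +-cancelˡ-≤ 2 k _ (≤-trans 2+k≤∣∁B∣
          (≤-trans (∣p∣≤1+∣p-x∣ (∁ B) v) (s≤s (∣p∣≤1+∣p-x∣ (∁ B - v) v'))))
      ; common = common }
    where
    v'∉B : v' ∉ B
    v'∉B = v'∉S₁ ∘ x∈p∪q⁺ ∘ inj₂
    v'≢v : v' ≢ v
    v'≢v refl = v'∉S₁ (x∈p∪q⁺ (inj₁ (x∈⁅x⁆ v)))
    u≢u' : u ≢ u'
    u≢u' refl = v'∉B (u-forces v' u'v' v'≢v)
    common : ∀ {x} → x ∈ ∁ B - v - v' → CommonNeighbour u u' x
    common {x} x∈D with x∈p-y⁻ (∁ B - v) x∈D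
    ... | x∈∁B-v , x≢v' with x∈p-y⁻ (∁ B) x∈∁B-v
    ... | x∈∁B , x≢v = forcer-adjacent u∈B u-forces x∉B x≢v , forcer-adjacent u'∈S₁ u'-forces x∉S₁ x≢v'
      where
      x∉B : x ∉ B
      x∉B = x∈∁p⇒x∉p x∈∁B
      x∉S₁ : x ∉ ⁅ v ⁆ ∪ B
      x∉S₁ = [ x≢v ∘ x∈⁅y⁆⇒x≡y v , x∉B ] ∘ x∈p∪q⁻ ⁅ v ⁆ B

  cactus⇒∣∁B∣≤4 : CyclesMeetInAtMostOneVertex → ∀ {B} → IsZeroForcingSet (complement G) B → ∣ ∁ B ∣ ≤ 4
  cactus⇒∣∁B∣≤4 cactus zf = ≮⇒≥ λ 5≤∣∁B∣ →
    let open CommonNeighbourhood (zeroForcing⇒commonNeighbourhood zf 5≤∣∁B∣)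
        (x , y , z , x∈D , y∈D , z∈D , x≢y , x≢z , y≢z) = choose₃ D k≤∣D∣
    in cactus⇒¬K₂₃ cactus u≢u' x≢y x≢z y≢z (common x∈D) (common y∈D) (common z∈D)

  ¬C₄⇒∣∁B∣≤3 : ¬ HasC4 G → ∀ {B} → IsZeroForcingSet (complement G) B → ∣ ∁ B ∣ ≤ 3
  ¬C₄⇒∣∁B∣≤3 noC4 zf = ≮⇒≥ λ 4≤∣∁B∣ →
    let open CommonNeighbourhood (zeroForcing⇒commonNeighbourhood zf 4≤∣∁B∣)
        (x , y , x∈D , y∈D , x≢y) = choose₂ D k≤∣D∣
    in noC4 (_ , square u≢u' x≢y (common x∈D) (common y∈D) , refl)

ZLowerBound-∁ : ∀ {n} (H : Graph n) k → (∀ {B} → IsZeroForcingSet H B → ∣ ∁ B ∣ ≤ k) →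
  ZLowerBound H (n ∸ k)
ZLowerBound-∁ {n} H k ∣∁B∣≤k B zf = m∸n≤o⇒m∸o≤n n ∣ B ∣ k (subst (_≤ k) (∣∁p∣≡n∸∣p∣ B) (∣∁B∣≤k zf))

lemma4p3 : (n : ℕ) → 4 ≤ n → (G : Graph n) → Cactus G → AtLeastTwoCycles G →
    ZLowerBound (complement G) (n ∸ 4) × (¬ HasC4 G → ZLowerBound (complement G) (n ∸ 3))
lemma4p3 n _ G (_ , cactus) _ =
  ZLowerBound-∁ (complement G) 4 (cactus⇒∣∁B∣≤4 G cactus) ,
  λ noC4 → ZLowerBound-∁ (complement G) 3 (¬C₄⇒∣∁B∣≤3 G noC4)
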